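{- Let $H$ be a hypergraph, $(Red,X,Blue)$ a partition of $V(H)$ such that no edge contains both a red and a blue vertex, and $F$ a reduced elimination forest of $H$. Let $U_0\subseteq Red\cup Blue$ be an $X$-homogenous context factor of $F$ with spine $P_0$, and let $P'$ be a colour interval of $P_0$. Then all vertices of $P'$ have the same foreign ball.
   Context: Hypergraph: finite vertex set, edges non-empty subsets; vertices adjacent if some edge contains both; $H[U]$ has vertex set $U$ and edges $\{e\cap U\neq\emptyset\}$. Elimination forest $F$: rooted forest on $V(H)$, vertices of a common edge in ancestor–descendant relation; $F_u$ = descendants of $u$; $\mathrm{bag}_F(u)$ = $u$ plus ancestors adjacent to $u$ or a descendant of $u$; reduced if each non-leaf $u$ is adjacent to some vertex of $F_v$ for each child $v$. Context factor: $F_x\setminus B$, $B$ a non-empty union of $F_y$ over sibling strict descendants $y$ of $x$; spine: path from $x$ to the parent of the $y$'s. Colour interval: maximal subpath of the spine contained in $Red$ or in $Blue$. For $u\in Red\cup Blue$, a connected component $W$ of $H[\mathrm{bag}_F(u)]$ is an $X$-component if $W\cap X\ne\emptyset$; otherwise it lies inside $Red$ or inside $Blue$ and is called a foreign component of $u$ if its colour differs from that of $u$. $X\text{ -ball}_F(u)$ is the union of $X$-components and the foreign ball $\mathrm{fball}_F(u)$ is the union of foreign components. $U_0$ is $X$-homogenous if all vertices of $P_0$ have the same $X$-ball. -}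

module Defs where

open import Data.Nat using (ℕ)
open import Data.Fin using (Fin)
open import Data.Fin.Subset using (Subset; _∈_; Nonempty)
open import Data.Maybe using (Maybe; just)
open import Data.Product using (Σ; ∃; _×_; _,_)
open import Data.Sum using (_⊎_)
open import Relation.Nullary using (¬_)
open import Relation.Binary.PropositionalEquality using (_≡_; _≢_)
open import Relation.Binary.Construct.Closure.ReflexiveTransitive using (Star)

record Hypergraph (n : ℕ) : Set where
  field
    m        : ℕ
    edge     : Fin m → Subset n
    nonempty : (i : Fin m) → Nonempty (edge i)

open Hypergraph public

module _ {n : ℕ} (H : Hypergraph n) where
  Adj : Fin n → Fin n → Set
  Adj u v = ∃ λ (i : Fin (m H)) → u ∈ edge H i × v ∈ edge H i

module _ {n : ℕ} (parent : Fin n → Maybe (Fin n)) where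
  -- Anc u v : u is a strict ancestor of v
  data Anc : Fin n → Fin n → Set where
    here  : ∀ {u v} → parent v ≡ just u → Anc u v
    there : ∀ {u w v} → parent v ≡ just w → Anc u w → Anc u v

  -- Desc u v : v ∈ F_u (v is a descendant of u, u itself included)
  Desc : Fin n → Fin n → Set
  Desc u v = v ≡ u ⊎ Anc u v

record Forest (n : ℕ) : Set where
  field
    parent  : Fin n → Maybe (Fin n)
    acyclic : ∀ v → ¬ Anc parent v v

open Forest public

module _ {n : ℕ} (H : Hypergraph n) (F : Forest n) where
  private
    A = Anc (parent F)
    D = Desc (parent F)

  IsEliminationForest : Set
  IsEliminationForest = ∀ (i : Fin (m H)) u v → u ∈ edge H i → v ∈ edge H i →
    u ≡ v ⊎ A u v ⊎ A v u

  IsReduced : Set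
  IsReduced = ∀ u v → parent F v ≡ just u → ∃ λ d → D v d × Adj H u d

  bag : Fin n → Fin n → Set
  bag u w = w ≡ u ⊎ (A w u × ∃ λ d → D u d × Adj H w d)

-- Connectivity inside the induced subhypergraph H[U]
-- (an edge e ∩ U of H[U] contains x and y iff e contains x and y and x, y ∈ U).
module _ {n : ℕ} (H : Hypergraph n) (U : Fin n → Set) where
  StepIn : Fin n → Fin n → Set
  StepIn x y = U x × U y × Adj H x y

  -- w and z lie in the same connected component of H[U] (w ∈ U assumed separately)
  ConnIn : Fin n → Fin n → Set
  ConnIn = Star StepIn

data Colour : Set where
  red xc blue : Colour

module _ {n : ℕ} (H : Hypergraph n) (F : Forest n) (col : Fin n → Colour) where
  Xball : Fin n → Fin n → Set
  Xball u w = bag H F u w × ∃ λ z → col z ≡ xc × ConnIn H (bag H F u) w z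

  -- fball_F(u): union of the components of H[bag_F(u)] that avoid X and are
  -- contained in a colour class c (Red or Blue) different from the colour of u
  fball : Fin n → Fin n → Set
  fball u w = bag H F u w × ∃ λ c → c ≢ xc × c ≢ col u ×
              (∀ z → ConnIn H (bag H F u) w z → col z ≡ c)

module _ {n : ℕ} (F : Forest n) where
  private
    D = Desc (parent F)

  -- Context factor data: x, the common parent p of the siblings y ∈ Y,
  -- with p ∈ F_x (so every y is a strict descendant of x), Y non-empty.
  record ContextFactor : Set where
    field
      top    : Fin n
      bottom : Fin n
      Y      : Subset n
      Y-ne   : Nonempty Y
      Y-sib  : ∀ y → y ∈ Y → parent F y ≡ just bottom
      bot∈F  : D top bottom

  module _ (C : ContextFactor) where
    open ContextFactor C
    -- U_0 = F_x \ ⋃_{y ∈ Y} F_y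
    carrier : Fin n → Set
    carrier w = D top w × ¬ (∃ λ y → y ∈ Y × D y w)

    spine : Fin n → Set
    spine z = D top z × D z bottom

  subpath : Fin n → Fin n → Fin n → Set
  subpath a b z = D a z × D z b

module _ {n : ℕ} (F : Forest n) (col : Fin n → Colour) (C : ContextFactor F) where
  private
    D = Desc (parent F)
    P₀ = spine F C

  MonoSubpath : Fin n → Fin n → Set
  MonoSubpath a b = P₀ a × P₀ b × D a b ×
    ∃ λ c → c ≢ xc × (∀ z → subpath F a b z → col z ≡ c)

  IsColourInterval : Fin n → Fin n → Set
  IsColourInterval a b = MonoSubpath a b ×
    (∀ a' b' → MonoSubpath a' b' → D a' a → D b b' → a' ≡ a × b' ≡ b)

module Submission where

-- Let c be the colour of the interval [a,b]. A subtree hanging off the interval lies in U₀,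
-- so it avoids X; in a reduced forest such a subtree is monochromatic and has a neighbour of
-- its parent, and since no edge joins Red and Blue it has colour c. Hence, for z on [a,b],
-- every vertex of F_z outside F_b has colour c, so a vertex of colour other than c lies in
-- bag(z) iff it lies in bag(b). A foreign component of z through w is then also one of z':
-- if the component of w in bag(z') met X, w would lie in the X-ball of z', which by
-- homogeneity is the X-ball of z, whereas the component of w in bag(z) avoids X.

open import Defs
open import Data.Nat using (ℕ)
open import Data.Fin using (Fin; _≟_)
open import Data.Fin.Subset using (_∈_)
open import Data.Fin.Induction using (spo-noetherian)
open import Data.Maybe using (just)
open import Data.Maybe.Properties using (just-injective)
open import Data.Product using (∃; _×_; _,_; proj₂)
open import Data.Sum using (_⊎_; inj₁; inj₂; [_,_])
open import Data.Empty using (⊥)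
open import Relation.Nullary using (¬_; yes; no; contradiction)
open import Relation.Binary.PropositionalEquality
  using (_≡_; _≢_; refl; sym; trans; isEquivalence; module ≡-Reasoning)
open import Relation.Binary.Construct.Closure.ReflexiveTransitive using (ε; _◅_)
open import Induction.WellFounded using (Acc; acc; WellFounded)
open import Function using (flip; _∘_)
open import Function.Bundles using (_⇔_; mk⇔; Equivalence)

module ForestOrder {n : ℕ} (F : Forest n) where
  A = Anc (parent F)
  D = Desc (parent F)

  anc-trans : ∀ {u v w} → A u v → A v w → A u w
  anc-trans u<v (here w↑v) = there w↑v u<v
  anc-trans u<v (there w↑x v<x) = there w↑x (anc-trans u<v v<x)

  desc-anc-trans : ∀ {u v w} → D u v → A v w → A u w
  desc-anc-trans (inj₁ refl) v<w = v<w
  desc-anc-trans (inj₂ u<v) v<w = anc-trans u<v v<w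

  anc-desc-trans : ∀ {u v w} → A u v → D v w → A u w
  anc-desc-trans u<v (inj₁ refl) = u<v
  anc-desc-trans u<v (inj₂ v<w) = anc-trans u<v v<w

  desc-trans : ∀ {u v w} → D u v → D v w → D u w
  desc-trans u≤v (inj₁ refl) = u≤v
  desc-trans u≤v (inj₂ v<w) = inj₂ (desc-anc-trans u≤v v<w)

  anc⇒desc-child : ∀ {t e} → A t e → ∃ λ t₁ → parent F t₁ ≡ just t × D t₁ e
  anc⇒desc-child {e = e} (here e↑t) = e , e↑t , inj₁ refl
  anc⇒desc-child (there e↑w t<w) with anc⇒desc-child t<w
  ... | t₁ , t₁↑t , inj₁ refl = t₁ , t₁↑t , inj₂ (here e↑w)
  ... | t₁ , t₁↑t , inj₂ t₁<w = t₁ , t₁↑t , inj₂ (there e↑w t₁<w)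

  anc⇒desc-parent : ∀ {u v p} → A u v → parent F v ≡ just p → D u p
  anc⇒desc-parent (here v↑u) v↑p = inj₁ (just-injective (trans (sym v↑p) v↑u))
  anc⇒desc-parent (there v↑w u<w) v↑p rewrite just-injective (trans (sym v↑p) v↑w) = inj₂ u<w

  anc-comparable : ∀ {u u' v} → A u v → A u' v → u ≡ u' ⊎ A u u' ⊎ A u' u
  anc-comparable (here p) (here p') = inj₁ (just-injective (trans (sym p) p'))
  anc-comparable (here p) (there p' q') rewrite just-injective (trans (sym p) p') = inj₂ (inj₂ q')
  anc-comparable (there p q) (here p') rewrite just-injective (trans (sym p) p') = inj₂ (inj₁ q)
  anc-comparable (there p q) (there p' q') rewrite just-injective (trans (sym p) p') = anc-comparable q q'

  desc-comparable : ∀ {u u' v} → D u v → D u' v → u ≡ u' ⊎ A u u' ⊎ A u' u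
  desc-comparable (inj₁ refl) (inj₁ refl) = inj₁ refl
  desc-comparable (inj₁ refl) (inj₂ u'<v) = inj₂ (inj₂ u'<v)
  desc-comparable (inj₂ u<v) (inj₁ refl) = inj₂ (inj₁ u<v)
  desc-comparable (inj₂ u<v) (inj₂ u'<v) = anc-comparable u<v u'<v

  siblings-disjoint : ∀ {s t t' e} → parent F t ≡ just s → parent F t' ≡ just s → t ≢ t' →
    D t e → D t' e → ⊥
  siblings-disjoint {s} t↑s t'↑s t≢t' t≤e t'≤e with desc-comparable t≤e t'≤e
  ... | inj₁ t≡t' = t≢t' t≡t'
  ... | inj₂ (inj₁ t<t') = acyclic F s (anc-desc-trans (here t↑s) (anc⇒desc-parent t<t' t'↑s))
  ... | inj₂ (inj₂ t'<t) = acyclic F s (anc-desc-trans (here t'↑s) (anc⇒desc-parent t'<t t↑s))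

  descendant-wellFounded : WellFounded (flip A)
  descendant-wellFounded = spo-noetherian record
    { isEquivalence = isEquivalence
    ; irrefl = λ { refl → acyclic F _ }
    ; trans = anc-trans
    ; <-resp-≈ = (λ { refl u<v → u<v }) , (λ { refl u<v → u<v })
    }

module Colouring {n : ℕ} (H : Hypergraph n) (col : Fin n → Colour)
    (no-red-blue-edge : ∀ (i : Fin (m H)) u v → u ∈ edge H i → v ∈ edge H i →
      ¬ (col u ≡ red × col v ≡ blue)) where

  adj⇒same-colour : ∀ {u v} → Adj H u v → col u ≢ xc → col v ≢ xc → col u ≡ col v
  adj⇒same-colour {u} {v} (i , u∈i , v∈i) u≢x v≢x with col u in cu | col v in cv
  ... | red  | red  = refl
  ... | blue | blue = refl
  ... | red  | blue = contradiction (cu , cv) (no-red-blue-edge i u v u∈i v∈i)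
  ... | blue | red  = contradiction (cv , cu) (no-red-blue-edge i v u v∈i u∈i)
  ... | xc   | _    = contradiction refl u≢x
  ... | _    | xc   = contradiction refl v≢x

  connected⇒same-colour : ∀ {U w y} → (∀ v → ConnIn H U w v → col v ≢ xc) →
    ConnIn H U w y → col y ≡ col w
  connected⇒same-colour avoidX ε = refl
  connected⇒same-colour avoidX (step ◅ path) =
    trans (connected⇒same-colour (λ v path' → avoidX v (step ◅ path')) path)
          (sym (adj⇒same-colour (proj₂ (proj₂ step)) (avoidX _ ε) (avoidX _ (step ◅ ε))))

  module _ (F : Forest n) where

    fball-transfer : ∀ {z z'} → col z ≡ col z' →
      (∀ w → col w ≢ xc → col w ≢ col z → bag H F z w → bag H F z' w) →
      (∀ w → Xball H F col z' w → Xball H F col z w) →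
      ∀ w → fball H F col z w → fball H F col z' w
    fball-transfer {z' = z'} cz≡cz' bag-transfer Xball-transfer w
      (w∈bag , c , c≢x , c≢cz , component-coloured) =
      w∈bag' , c , c≢x , (λ c≡cz' → c≢cz (trans c≡cz' (sym cz≡cz'))) ,
      λ y path → trans (connected⇒same-colour avoidX path) cw
      where
        cw : col w ≡ c
        cw = component-coloured w ε

        w∈bag' : bag H F z' w
        w∈bag' = bag-transfer w (λ wx → c≢x (trans (sym cw) wx)) (λ wz → c≢cz (trans (sym cw) wz))
                   w∈bag

        avoidX : ∀ v → ConnIn H (bag H F z') w v → col v ≢ xc
        avoidX v path vx with Xball-transfer w (w∈bag' , v , vx , path)
        ... | _ , x , cx , path' = c≢x (trans (sym (component-coloured x path')) cx)

    open ForestOrder F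

    module _ (reduced : IsReduced H F) where

      subtree-monochromatic : ∀ t → (∀ e → D t e → col e ≢ xc) → ∀ e → D t e → col e ≡ col t
      subtree-monochromatic t = go t (descendant-wellFounded t)
        where
          go : ∀ t → Acc (flip A) t → (∀ e → D t e → col e ≢ xc) → ∀ e → D t e → col e ≡ col t
          go t _ avoidX e (inj₁ refl) = refl
          go t (acc below) avoidX e (inj₂ t<e) with anc⇒desc-child t<e
          ... | t₁ , t₁↑t , t₁≤e with reduced t t₁ t₁↑t
          ... | d , t₁≤d , t~d = begin
              col e  ≡⟨ ih e t₁≤e ⟩
              col t₁ ≡⟨ sym (ih d t₁≤d) ⟩
              col d  ≡⟨ sym (adj⇒same-colour t~d (avoidX t (inj₁ refl)) (avoidX d (t≤ t₁≤d))) ⟩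
              col t  ∎
            where
              open ≡-Reasoning
              t≤ : ∀ {e} → D t₁ e → D t e
              t≤ t₁≤e = inj₂ (anc-desc-trans (here t₁↑t) t₁≤e)
              ih : ∀ e → D t₁ e → col e ≡ col t₁
              ih = go t₁ (below (here t₁↑t)) (λ e' t₁≤e' → avoidX e' (t≤ t₁≤e'))

      module Interval (a b : Fin n) (c : Colour) (c≢x : c ≢ xc)
          (coloured : ∀ z → subpath F a b z → col z ≡ c)
          (off-interval-avoidX : ∀ e → D a e → ¬ D b e → col e ≢ xc) where

        c-coloured⇒≢x : ∀ {d} → col d ≡ c → col d ≢ xc
        c-coloured⇒≢x cd dx = c≢x (trans (sym cd) dx)

        off-path-child-colour : ∀ {w v t} → parent F v ≡ just w → parent F t ≡ just w → t ≢ v →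
          subpath F a b w → D v b → ∀ e → D t e → col e ≡ c
        off-path-child-colour {w} {v} {t} v↑w t↑w t≢v w∈@(a≤w , _) v≤b e t≤e
          with reduced w t t↑w
        ... | d , t≤d , w~d = begin
            col e ≡⟨ subtree-monochromatic t avoidX e t≤e ⟩
            col t ≡⟨ sym (subtree-monochromatic t avoidX d t≤d) ⟩
            col d ≡⟨ sym (adj⇒same-colour w~d (c-coloured⇒≢x (coloured w w∈)) (avoidX d t≤d)) ⟩
            col w ≡⟨ coloured w w∈ ⟩
            c     ∎
          where
            open ≡-Reasoning
            avoidX : ∀ e → D t e → col e ≢ xc
            avoidX e t≤e = off-interval-avoidX e
              (desc-trans a≤w (inj₂ (anc-desc-trans (here t↑w) t≤e)))
              (λ b≤e → siblings-disjoint t↑w v↑w t≢v t≤e (desc-trans v≤b b≤e))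

        descend-child : ∀ {w v} → subpath F a b w → parent F v ≡ just w → D v b →
          ∀ d → D w d → D v d ⊎ col d ≡ c
        descend-child w∈ v↑w v≤b d (inj₁ refl) = inj₂ (coloured d w∈)
        descend-child {v = v} w∈ v↑w v≤b d (inj₂ w<d) with anc⇒desc-child w<d
        ... | t , t↑w , t≤d with t ≟ v
        ... | yes refl = inj₁ t≤d
        ... | no t≢v = inj₂ (off-path-child-colour v↑w t↑w t≢v w∈ v≤b d t≤d)

        descend : ∀ {s v} → subpath F a b s → A s v → D v b → ∀ d → D s d → D v d ⊎ col d ≡ c
        descend s∈ (here v↑s) v≤b d s≤d = descend-child s∈ v↑s v≤b d s≤d
        descend s∈@(a≤s , _) (there {w = w} v↑w s<w) v≤b d s≤d =
          [ descend-child (desc-trans a≤s (inj₂ s<w) , w≤b) v↑w v≤b d , inj₂ ]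
            (descend s∈ s<w w≤b d s≤d)
          where
            w≤b : D w b
            w≤b = desc-trans (inj₂ (here v↑w)) v≤b

        below-interval : ∀ {z} → subpath F a b z → ∀ d → D z d → D b d ⊎ col d ≡ c
        below-interval (_ , inj₁ refl) d z≤d = inj₁ z≤d
        below-interval z∈@(_ , inj₂ z<b) d z≤d = descend z∈ z<b (inj₁ refl) d z≤d

        bag-to-bottom : ∀ {z w} → subpath F a b z → col w ≢ xc → col w ≢ c →
          bag H F z w → bag H F b w
        bag-to-bottom z∈ w≢x w≢c (inj₁ refl) = contradiction (coloured _ z∈) w≢c
        bag-to-bottom z∈@(_ , z≤b) w≢x w≢c (inj₂ (w<z , d , z≤d , w~d)) =
          [ (λ b≤d → inj₂ (anc-desc-trans w<z z≤b , d , b≤d , w~d))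
          , (λ cd → contradiction (trans (adj⇒same-colour w~d w≢x (c-coloured⇒≢x cd)) cd) w≢c) ]
            (below-interval z∈ d z≤d)

        bag-from-bottom : ∀ {z w} → subpath F a b z → col w ≢ xc → col w ≢ c →
          bag H F b w → bag H F z w
        bag-from-bottom (a≤z , z≤b) w≢x w≢c (inj₁ refl) =
          contradiction (coloured _ (desc-trans a≤z z≤b , inj₁ refl)) w≢c
        bag-from-bottom (a≤z , z≤b) w≢x w≢c (inj₂ (w<b , d , b≤d , w~d))
          with desc-comparable (inj₂ w<b) z≤b
        ... | inj₁ refl = contradiction (coloured _ (a≤z , z≤b)) w≢c
        ... | inj₂ (inj₁ w<z) = inj₂ (w<z , d , desc-trans z≤b b≤d , w~d)
        ... | inj₂ (inj₂ z<w) =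
          contradiction (coloured _ (desc-trans a≤z (inj₂ z<w) , inj₂ w<b)) w≢c

module _ {n : ℕ} (F : Forest n) (C : ContextFactor F) where
  open ForestOrder F
  open ContextFactor C

  spine-off-interval⇒carrier : ∀ {a b e} → spine F C a → spine F C b →
    D a e → ¬ D b e → carrier F C e
  spine-off-interval⇒carrier (top≤a , _) (_ , b≤bottom) a≤e b≰e =
    desc-trans top≤a a≤e ,
    λ { (y , y∈Y , y≤e) →
          b≰e (desc-trans (inj₂ (desc-anc-trans b≤bottom (here (Y-sib y y∈Y)))) y≤e) }

  interval⊆spine : ∀ {a b z} → spine F C a → spine F C b → subpath F a b z → spine F C z
  interval⊆spine (top≤a , _) (_ , b≤bottom) (a≤z , z≤b) =
    desc-trans top≤a a≤z , desc-trans z≤b b≤bottom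

lemma39 : ∀ {n : ℕ} (H : Hypergraph n) (col : Fin n → Colour) →
    (∀ (i : Fin (m H)) u v → u ∈ edge H i → v ∈ edge H i →
    ¬ (col u ≡ red × col v ≡ blue)) →
    (F : Forest n) → IsEliminationForest H F → IsReduced H F →
    (C : ContextFactor F) →
    (∀ w → carrier F C w → col w ≢ xc) →
    (∀ z z' → spine F C z → spine F C z' → ∀ w → Xball H F col z w ⇔ Xball H F col z' w) →
    (a b : Fin n) → IsColourInterval F col C a b →
    ∀ z z' → subpath F a b z → subpath F a b z' →
    ∀ w → fball H F col z w ⇔ fball H F col z' w
lemma39 H col no-red-blue-edge F _ reduced C U₀-avoidsX homogeneous a b
  ((a∈P₀ , b∈P₀ , _ , c , c≢x , coloured) , _) z z' z∈ z'∈ w =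
  mk⇔ (transfer z∈ z'∈ w) (transfer z'∈ z∈ w)
  where
    open Colouring H col no-red-blue-edge
    open Interval F reduced a b c c≢x coloured
      (λ e a≤e b≰e → U₀-avoidsX e (spine-off-interval⇒carrier F C a∈P₀ b∈P₀ a≤e b≰e))

    on-spine : ∀ {z} → subpath F a b z → spine F C z
    on-spine = interval⊆spine F C a∈P₀ b∈P₀

    transfer : ∀ {z z'} → subpath F a b z → subpath F a b z' →
      ∀ w → fball H F col z w → fball H F col z' w
    transfer {z} {z'} z∈ z'∈ = fball-transfer F
      (trans (coloured z z∈) (sym (coloured z' z'∈)))
      (λ w w≢x w≢cz → let w≢c = λ wc → w≢cz (trans wc (sym (coloured z z∈))) in
        bag-from-bottom z'∈ w≢x w≢c ∘ bag-to-bottom z∈ w≢x w≢c)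
      (λ w → Equivalence.to (homogeneous z' z (on-spine z'∈) (on-spine z∈) w))
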